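{- Let $a_{13},a_{14},a_{24}>0$ and let $$A=\begin{bmatrix}1&1&a_{13}&a_{14}&1\\ 1&1&1&a_{24}&1\\ \frac1{a_{13}}&1&1&1&1\\ \frac1{a_{14}}&\frac1{a_{24}}&1&1&1\\ 1&1&1&1&1\end{bmatrix}\in\mathcal{PC}_5 .$$ Suppose that one of the following conditions holds: (1) $1<a_{24}<a_{14}<a_{13}$; (2) $a_{24}<1<a_{13}<a_{14}$. Then $\mathcal{C}(A)$ is not contained in $\mathcal{E}(A)$.
   Context: $\mathcal{PC}_n$ denotes the set of $n$-by-$n$ reciprocal matrices, i.e. entrywise positive matrices $[a_{ij}]$ with $a_{ji}=1/a_{ij}$. A positive vector $w$ is efficient for $A=[a_{ij}]\in\mathcal{PC}_n$ if for every positive vector $v$, $|a_{ij}-v_i/v_j|\le|a_{ij}-w_i/w_j|$ for all $i,j$ implies $v$ is a positive multiple of $w$; $\mathcal{E}(A)$ is the set of efficient vectors for $A$. $\mathcal{C}(A)$ is the set of nonzero nonnegative linear combinations of the columns of $A$ (the zero vector excluded). -}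

module Defs where

open import Level using (0ℓ)
open import Data.Nat using (ℕ; zero; suc)
open import Data.Fin using (Fin; zero; suc)
open import Data.Product using (Σ; ∃; _×_; _,_)
open import Data.Sum using (_⊎_)
open import Relation.Nullary using (¬_)
open import Relation.Binary.PropositionalEquality using (_≡_)
open import Relation.Binary.Structures using (IsStrictTotalOrder)
open import Relation.Binary.Definitions using (tri<; tri≈; tri>)
open import Algebra.Structures using (IsCommutativeRing)

-- The real numbers, axiomatised as a (Dedekind-)complete ordered field
-- (unique up to isomorphism).  All statements below are made for an
-- arbitrary such structure.
record RealField : Set₁ where
  infixl 6 _+_
  infixl 7 _*_
  infix  4 _<_ _≤_
  infixl 6 _-_
  infixl 7 _/_
  infix  8 -_
  infix  9 _⁻¹
  field
    ℝ     : Set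
    _+_   : ℝ → ℝ → ℝ
    _*_   : ℝ → ℝ → ℝ
    -_    : ℝ → ℝ
    0#    : ℝ
    1#    : ℝ
    _⁻¹   : ℝ → ℝ
    _<_   : ℝ → ℝ → Set
    isCommutativeRing : IsCommutativeRing _≡_ _+_ _*_ -_ 0# 1#
    0≢1   : ¬ (0# ≡ 1#)
    ⁻¹-inverse : ∀ x → ¬ (x ≡ 0#) → x * (x ⁻¹) ≡ 1#
    isStrictTotalOrder : IsStrictTotalOrder _≡_ _<_
    +-mono-< : ∀ {x y} z → x < y → x + z < y + z
    *-pos    : ∀ {x y} → 0# < x → 0# < y → 0# < x * y

  _≤_ : ℝ → ℝ → Set
  x ≤ y = x < y ⊎ x ≡ y

  field
    complete : (P : ℝ → Set) → ∃ P → (∃ λ b → ∀ x → P x → x ≤ b) →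
               ∃ λ s → (∀ x → P x → x ≤ s) ×
                        (∀ b → (∀ x → P x → x ≤ b) → s ≤ b)

  _-_ : ℝ → ℝ → ℝ
  x - y = x + (- y)

  _/_ : ℝ → ℝ → ℝ
  x / y = x * (y ⁻¹)

  ∣_∣ : ℝ → ℝ
  ∣ x ∣ with IsStrictTotalOrder.compare isStrictTotalOrder x 0#
  ... | tri< _ _ _ = - x
  ... | tri≈ _ _ _ = x
  ... | tri> _ _ _ = x

module Reciprocal (R : RealField) where
  open RealField R

  Matrix : ℕ → Set
  Matrix n = Fin n → Fin n → ℝ

  Vector : ℕ → Set
  Vector n = Fin n → ℝ

  sumF : ∀ n → (Fin n → ℝ) → ℝ
  sumF zero    f = 0#
  sumF (suc n) f = f zero + sumF n (λ i → f (suc i))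

  Positive : ∀ {n} → Vector n → Set
  Positive w = ∀ i → 0# < w i

  IsReciprocal : ∀ {n} → Matrix n → Set
  IsReciprocal A = (∀ i j → 0# < A i j) × (∀ i j → A j i ≡ 1# / A i j)

  Efficient : ∀ {n} → Matrix n → Vector n → Set
  Efficient A w =
    Positive w ×
    (∀ v → Positive v →
       (∀ i j → ∣ A i j - v i / v j ∣ ≤ ∣ A i j - w i / w j ∣) →
       ∃ λ c → 0# < c × (∀ i → v i ≡ c * w i))

  InCone : ∀ {n} → Matrix n → Vector n → Set
  InCone {n} A w =
    (∃ λ (c : Vector n) → (∀ j → 0# ≤ c j) ×
                          (∀ i → w i ≡ sumF n (λ j → A i j * c j))) ×
    ¬ (∀ i → w i ≡ 0#)

  A₅ : ℝ → ℝ → ℝ → Matrix 5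
  A₅ a₁₃ a₁₄ a₂₄ = λ where
    zero                   (suc (suc zero))             → a₁₃
    zero                   (suc (suc (suc zero)))       → a₁₄
    (suc zero)             (suc (suc (suc zero)))       → a₂₄
    (suc (suc zero))       zero                         → 1# / a₁₃
    (suc (suc (suc zero))) zero                         → 1# / a₁₄
    (suc (suc (suc zero))) (suc zero)                   → 1# / a₂₄
    _                      _                            → 1#

{-# OPTIONS --safe #-}
-- Raising one coordinate w k of a positive vector to a value t with
-- w k < t ≤ a_kj w_j for all j ≠ k moves every ratio in row k towards the
-- entry of A, and by reciprocity every ratio in column k as well, while all
-- other ratios stay fixed; so such a w is not efficient.  In both cases some
-- nonnegative combination of the columns of A has such a coordinate
-- (coordinates numbered from 1 as in the paper, so w₄ is w 3F).
-- If 1 < a₂₄ < a₁₄ < a₁₃, write a₂₄ = 1 + e, a₁₄ = a₂₄ + f, a₁₃ = a₁₄ + g and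
-- s = e + f + g: the coefficients (e a₁₃, g, f, 0, 0) give
-- w = (a₁₄ s, a₂₄ s, s, w₄, a₂₄ s) with a₁₄ a₂₄ (s - w₄) = e f g > 0, and w₄
-- can be raised to s.  If a₂₄ < 1 < a₁₃ < a₁₄, write a₁₃ = 1 + k,
-- a₁₄ = a₁₃ + m, 1 = a₂₄ + h and s = m + k + h: the coefficients
-- (h a₁₄, m a₂₄, 0, k, 0) give w = (a₁₃ s, s, w₃, s, s + h k) with
-- a₁₃ (s - w₃) = k m h > 0, and w₃ can be raised to s.

module Submission where

open import Defs
open import Level using (0ℓ)
open import Algebra.Bundles using (CommutativeRing)
open import Algebra.Structures using (IsCommutativeRing)
open import Data.Fin using (Fin; zero; _≟_)
open import Data.Fin.Patterns using (0F; 1F; 2F; 3F; 4F)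
open import Data.Fin.Properties using (punchInᵢ≢i)
open import Data.Nat using (suc)
open import Data.Product using (_×_; _,_)
open import Data.Sum using (_⊎_; inj₁; inj₂)
open import Data.Vec.Functional using (updateAt; _∷_; [])
open import Data.Vec.Functional.Properties using (updateAt-updates; updateAt-minimal)
open import Function using (const)
open import Relation.Binary.Bundles using (StrictPartialOrder)
open import Relation.Binary.Definitions using (tri<; tri≈; tri>)
open import Relation.Binary.PropositionalEquality
import Relation.Binary.Reasoning.StrictPartialOrder
import Algebra.Solver.Ring.NaturalCoefficients.Default
open import Relation.Binary.Structures using (IsStrictTotalOrder)
open import Relation.Nullary using (¬_; yes; no; contradiction)

module OrderedFieldProperties (R : RealField) where
  open RealField R
  open IsCommutativeRing isCommutativeRing
    using (+-assoc; +-comm; +-identityˡ; +-identityʳ; -‿inverseˡ; -‿inverseʳ;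
           *-assoc; *-comm; *-identityˡ; *-identityʳ; zeroʳ)
  open IsStrictTotalOrder isStrictTotalOrder
    using (compare; isStrictPartialOrder) renaming (trans to <-trans; irrefl to <-irrefl)

  commutativeRing : CommutativeRing 0ℓ 0ℓ
  commutativeRing = record { isCommutativeRing = isCommutativeRing }

  open import Algebra.Properties.Ring (CommutativeRing.ring commutativeRing)
    using (-0#≈0#; -‿involutive; -1*x≈-x; [y-z]x≈yx-zx)
  open import Algebra.Properties.CommutativeSemigroup
    (CommutativeRing.*-commutativeSemigroup commutativeRing) using (x∙yz≈y∙xz)
  module SemiringSolver = Algebra.Solver.Ring.NaturalCoefficients.Default
    (CommutativeRing.commutativeSemiring commutativeRing)
  open SemiringSolver using (solve; _:=_; _:+_; _:*_)

  strictPartialOrder : StrictPartialOrder 0ℓ 0ℓ 0ℓ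
  strictPartialOrder = record { isStrictPartialOrder = isStrictPartialOrder }

  module <-Reasoning = Relation.Binary.Reasoning.StrictPartialOrder strictPartialOrder

  private variable x y z a : ℝ

  <-irrefl′ : ¬ (x < x)
  <-irrefl′ = <-irrefl refl

  >0⇒≢0 : 0# < x → x ≢ 0#
  >0⇒≢0 0<x x≡0 = <-irrefl (sym x≡0) 0<x

  y-x+x≡y : y - x + x ≡ y
  y-x+x≡y {y} {x} = trans (+-assoc y (- x) x) (trans (cong (y +_) (-‿inverseˡ x)) (+-identityʳ y))

  x+[y-x]≡y : x + (y - x) ≡ y
  x+[y-x]≡y {x} {y} = trans (+-comm x (y - x)) y-x+x≡y

  x<y⇒0<y-x : x < y → 0# < y - x
  x<y⇒0<y-x {x} {y} x<y = subst (_< y - x) (-‿inverseʳ x) (+-mono-< (- x) x<y)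

  0<y-x⇒x<y : 0# < y - x → x < y
  0<y-x⇒x<y {y} {x} 0<y-x = subst₂ _<_ (+-identityˡ x) y-x+x≡y (+-mono-< x 0<y-x)

  x<y⇒x-y<0 : x < y → x - y < 0#
  x<y⇒x-y<0 {x} {y} x<y = subst (x - y <_) (-‿inverseʳ y) (+-mono-< (- y) x<y)

  x≤y⇒0≤y-x : x ≤ y → 0# ≤ y - x
  x≤y⇒0≤y-x (inj₁ x<y)       = inj₁ (x<y⇒0<y-x x<y)
  x≤y⇒0≤y-x {x} (inj₂ refl) = inj₂ (sym (-‿inverseʳ x))

  x≤y⇒x-y≤0 : x ≤ y → x - y ≤ 0#
  x≤y⇒x-y≤0 (inj₁ x<y)       = inj₁ (x<y⇒x-y<0 x<y)
  x≤y⇒x-y≤0 {x} (inj₂ refl) = inj₂ (-‿inverseʳ x)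

  x<x+y : 0# < y → x < x + y
  x<x+y {y} {x} 0<y = subst₂ _<_ (+-identityˡ x) (+-comm y x) (+-mono-< x 0<y)

  +-pos : 0# < x → 0# < y → 0# < x + y
  +-pos 0<x 0<y = <-trans 0<x (x<x+y 0<y)

  -‿anti-< : x < y → - y < - x
  -‿anti-< {x} {y} x<y = 0<y-x⇒x<y (subst (0# <_) y-x≡-x+--y (x<y⇒0<y-x x<y))
    where
    y-x≡-x+--y : y - x ≡ - x - - y
    y-x≡-x+--y = trans (+-comm y (- x)) (cong (- x +_) (sym (-‿involutive y)))

  x<y⇒z-y<z-x : x < y → z - y < z - x
  x<y⇒z-y<z-x {x} {y} {z} x<y = subst₂ _<_ (+-comm (- y) z) (+-comm (- x) z) (+-mono-< z (-‿anti-< x<y))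

  0<1 : 0# < 1#
  0<1 with compare 0# 1#
  ... | tri< 0<1 _ _ = 0<1
  ... | tri≈ _ 0≡1 _ = contradiction 0≡1 0≢1
  ... | tri> _ _ 1<0 = contradiction (<-trans 1<0 0<-1*-1) <-irrefl′
    where
    0<-1 : 0# < - 1#
    0<-1 = subst (0# <_) (+-identityˡ (- 1#)) (x<y⇒0<y-x 1<0)
    0<-1*-1 : 0# < 1#
    0<-1*-1 = subst (0# <_) (trans (-1*x≈-x (- 1#)) (-‿involutive 1#)) (*-pos 0<-1 0<-1)

  *-monoʳ-< : 0# < z → x < y → x * z < y * z
  *-monoʳ-< {z} {x} {y} 0<z x<y =
    0<y-x⇒x<y (subst (0# <_) ([y-z]x≈yx-zx z y x) (*-pos (x<y⇒0<y-x x<y) 0<z))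

  *-monoˡ-< : 0# < z → x < y → z * x < z * y
  *-monoˡ-< {z} {x} {y} 0<z x<y = subst₂ _<_ (*-comm x z) (*-comm y z) (*-monoʳ-< 0<z x<y)

  *-monoʳ-≤ : 0# < z → x ≤ y → x * z ≤ y * z
  *-monoʳ-≤ 0<z (inj₁ x<y)  = inj₁ (*-monoʳ-< 0<z x<y)
  *-monoʳ-≤ _   (inj₂ refl) = inj₂ refl

  *-cancelˡ-< : 0# < z → z * x < z * y → x < y
  *-cancelˡ-< {z} {x} {y} 0<z zx<zy with compare x y
  ... | tri< x<y _ _ = x<y
  ... | tri≈ _ refl _ = contradiction zx<zy <-irrefl′
  ... | tri> _ _ y<x = contradiction (<-trans zx<zy (*-monoˡ-< 0<z y<x)) <-irrefl′

  x*y/y≡x : y ≢ 0# → x * y / y ≡ x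
  x*y/y≡x {y} {x} y≢0 = trans (*-assoc x y (y ⁻¹)) (trans (cong (x *_) (⁻¹-inverse y y≢0)) (*-identityʳ x))

  x*[x⁻¹*y]≡y : x ≢ 0# → x * (x ⁻¹ * y) ≡ y
  x*[x⁻¹*y]≡y {x} {y} x≢0 =
    trans (sym (*-assoc x (x ⁻¹) y)) (trans (cong (_* y) (⁻¹-inverse x x≢0)) (*-identityˡ y))

  x*[y*x⁻¹]≡y : x ≢ 0# → x * (y * x ⁻¹) ≡ y
  x*[y*x⁻¹]≡y {x} {y} x≢0 =
    trans (x∙yz≈y∙xz x y (x ⁻¹)) (trans (cong (y *_) (⁻¹-inverse x x≢0)) (*-identityʳ y))

  x*y≡1⇒y≡x⁻¹ : x ≢ 0# → x * y ≡ 1# → y ≡ x ⁻¹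
  x*y≡1⇒y≡x⁻¹ {x} {y} x≢0 xy≡1 = begin
    y           ≡⟨ x*y/y≡x x≢0 ⟨
    y * x / x   ≡⟨ cong (_/ x) (trans (*-comm y x) xy≡1) ⟩
    1# * x ⁻¹   ≡⟨ *-identityˡ (x ⁻¹) ⟩
    x ⁻¹        ∎
    where open ≡-Reasoning

  x≡y*x⇒y≡1 : x ≢ 0# → x ≡ y * x → y ≡ 1#
  x≡y*x⇒y≡1 {x} {y} x≢0 x≡yx = begin
    y           ≡⟨ x*y/y≡x x≢0 ⟨
    y * x / x   ≡⟨ cong (_/ x) x≡yx ⟨
    x / x       ≡⟨ ⁻¹-inverse x x≢0 ⟩
    1#          ∎
    where open ≡-Reasoning

  [1/x]*[x*y]≡y : x ≢ 0# → 1# / x * (x * y) ≡ y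
  [1/x]*[x*y]≡y {x} {y} x≢0 = begin
    1# * x ⁻¹ * (x * y)   ≡⟨ cong (_* (x * y)) (*-identityˡ (x ⁻¹)) ⟩
    x ⁻¹ * (x * y)        ≡⟨ x∙yz≈y∙xz (x ⁻¹) x y ⟩
    x * (x ⁻¹ * y)        ≡⟨ x*[x⁻¹*y]≡y x≢0 ⟩
    y                     ∎
    where open ≡-Reasoning

  1≡1/1 : 1# ≡ 1# / 1#
  1≡1/1 = trans (x*y≡1⇒y≡x⁻¹ (>0⇒≢0 0<1) (*-identityˡ 1#)) (sym (*-identityˡ (1# ⁻¹)))

  ⁻¹-pos : 0# < x → 0# < x ⁻¹
  ⁻¹-pos {x} 0<x with compare 0# (x ⁻¹)
  ... | tri< 0<x⁻¹ _ _ = 0<x⁻¹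
  ... | tri≈ _ 0≡x⁻¹ _ =
    contradiction (trans (sym (zeroʳ x)) (trans (cong (x *_) 0≡x⁻¹) (⁻¹-inverse x (>0⇒≢0 0<x)))) 0≢1
  ... | tri> _ _ x⁻¹<0 = contradiction (<-trans 0<1 1<0) <-irrefl′
    where
    1<0 : 1# < 0#
    1<0 = subst₂ _<_ (⁻¹-inverse x (>0⇒≢0 0<x)) (zeroʳ x) (*-monoˡ-< 0<x x⁻¹<0)

  0<1/x : 0# < x → 0# < 1# / x
  0<1/x 0<x = *-pos 0<1 (⁻¹-pos 0<x)

  x≡1/[1/x] : 0# < x → x ≡ 1# / (1# / x)
  x≡1/[1/x] {x} 0<x = begin
    x                  ≡⟨ x*y≡1⇒y≡x⁻¹ (>0⇒≢0 (0<1/x 0<x)) [1/x]*x≡1 ⟩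
    (1# / x) ⁻¹        ≡⟨ *-identityˡ ((1# / x) ⁻¹) ⟨
    1# / (1# / x)      ∎
    where
    open ≡-Reasoning
    [1/x]*x≡1 : 1# / x * x ≡ 1#
    [1/x]*x≡1 = trans (cong (_* x) (*-identityˡ (x ⁻¹))) (trans (*-comm (x ⁻¹) x) (⁻¹-inverse x (>0⇒≢0 0<x)))

  ⁻¹-anti-< : 0# < x → x < y → y ⁻¹ < x ⁻¹
  ⁻¹-anti-< {x} {y} 0<x x<y = begin-strict
    y ⁻¹                ≡⟨ x*[x⁻¹*y]≡y (>0⇒≢0 0<x) ⟨
    x * (x ⁻¹ * y ⁻¹)   <⟨ *-monoʳ-< (*-pos (⁻¹-pos 0<x) (⁻¹-pos 0<y)) x<y ⟩
    y * (x ⁻¹ * y ⁻¹)   ≡⟨ x*[y*x⁻¹]≡y (>0⇒≢0 0<y) ⟩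
    x ⁻¹                ∎
    where
    open <-Reasoning
    0<y : 0# < y
    0<y = <-trans 0<x x<y

  x≤y*z⇒x/z≤y : 0# < z → x ≤ y * z → x / z ≤ y
  x≤y*z⇒x/z≤y {z} {x} {y} 0<z x≤yz = begin
    x / z       ≤⟨ *-monoʳ-≤ (⁻¹-pos 0<z) x≤yz ⟩
    y * z / z   ≡⟨ x*y/y≡x (>0⇒≢0 0<z) ⟩
    y           ∎
    where open <-Reasoning

  x≤y*z⇒1/y≤z/x : 0# < x → 0# < y → x ≤ y * z → 1# / y ≤ z / x
  x≤y*z⇒1/y≤z/x {x} {y} {z} 0<x 0<y x≤yz = begin
    1# * y ⁻¹                ≡⟨ *-identityˡ (y ⁻¹) ⟩
    y ⁻¹                     ≡⟨ x*[x⁻¹*y]≡y (>0⇒≢0 0<x) ⟨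
    x * (x ⁻¹ * y ⁻¹)        ≤⟨ *-monoʳ-≤ (*-pos (⁻¹-pos 0<x) (⁻¹-pos 0<y)) x≤yz ⟩
    y * z * (x ⁻¹ * y ⁻¹)    ≡⟨ solve 4 (λ y z x⁻¹ y⁻¹ → y :* z :* (x⁻¹ :* y⁻¹) := y :* (z :* x⁻¹ :* y⁻¹))
                                   refl y z (x ⁻¹) (y ⁻¹) ⟩
    y * (z / x * y ⁻¹)       ≡⟨ x*[y*x⁻¹]≡y (>0⇒≢0 0<y) ⟩
    z / x                    ∎
    where open <-Reasoning

  x*y+a≡x*z⇒y<z : 0# < x → 0# < a → x * y + a ≡ x * z → y < z
  x*y+a≡x*z⇒y<z {x} {a} {y} {z} 0<x 0<a xy+a≡xz =
    *-cancelˡ-< 0<x (subst (x * y <_) xy+a≡xz (x<x+y 0<a))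

  ∣x∣≡x : 0# ≤ x → ∣ x ∣ ≡ x
  ∣x∣≡x {x} 0≤x with compare x 0#
  ... | tri< x<0 _ _ = contradiction (begin-strict 0# ≤⟨ 0≤x ⟩ x <⟨ x<0 ⟩ 0# ∎) <-irrefl′
    where open <-Reasoning
  ... | tri≈ _ _ _ = refl
  ... | tri> _ _ _ = refl

  ∣x∣≡-x : x ≤ 0# → ∣ x ∣ ≡ - x
  ∣x∣≡-x {x} x≤0 with compare x 0#
  ... | tri< _ _ _ = refl
  ... | tri≈ _ refl _ = sym -0#≈0#
  ... | tri> _ _ 0<x = contradiction (begin-strict 0# <⟨ 0<x ⟩ x ≤⟨ x≤0 ⟩ 0# ∎) <-irrefl′
    where open <-Reasoning

  closer-from-below : x < y → y ≤ a → ∣ a - y ∣ ≤ ∣ a - x ∣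
  closer-from-below {x} {y} {a} x<y y≤a =
    subst₂ _≤_ (sym (∣x∣≡x (x≤y⇒0≤y-x y≤a))) (sym (∣x∣≡x (inj₁ (x<y⇒0<y-x x<a))))
      (inj₁ (x<y⇒z-y<z-x x<y))
    where
    open <-Reasoning
    x<a : x < a
    x<a = begin-strict x <⟨ x<y ⟩ y ≤⟨ y≤a ⟩ a ∎

  closer-from-above : a ≤ y → y < x → ∣ a - y ∣ ≤ ∣ a - x ∣
  closer-from-above {a} {y} {x} a≤y y<x =
    subst₂ _≤_ (sym (∣x∣≡-x (x≤y⇒x-y≤0 a≤y))) (sym (∣x∣≡-x (inj₁ (x<y⇒x-y<0 a<x))))
      (inj₁ (-‿anti-< (x<y⇒z-y<z-x y<x)))
    where
    open <-Reasoning
    a<x : a < x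
    a<x = begin-strict a ≤⟨ a≤y ⟩ y <⟨ y<x ⟩ x ∎

module Efficiency (R : RealField) where
  open RealField R
  open Reciprocal R
  open OrderedFieldProperties R
  open IsCommutativeRing isCommutativeRing using (*-identityˡ)
  open IsStrictTotalOrder isStrictTotalOrder using () renaming (trans to <-trans)

  _·_ : ∀ {n} → Matrix n → Vector n → Vector n
  (A · c) i = sumF _ (λ j → A i j * c j)

  𝒞⊆ℰ : ∀ {n} → Matrix n → Set
  𝒞⊆ℰ A = ∀ w → InCone A w → Efficient A w

  ·-inCone : ∀ {n} (A : Matrix n) {c : Vector n} → (∀ j → 0# ≤ c j) →
             (i : Fin n) → (A · c) i ≢ 0# → InCone A (A · c)
  ·-inCone A {c} 0≤c i A·cᵢ≢0 = (c , 0≤c , λ _ → refl) , λ A·c≡0 → A·cᵢ≢0 (A·c≡0 i)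

  closer⇒¬efficient : ∀ {n} {A : Matrix n} {v w : Vector n} {k l : Fin n} →
    Positive v → (∀ i j → ∣ A i j - v i / v j ∣ ≤ ∣ A i j - w i / w j ∣) →
    v l ≡ w l → v k ≢ w k → ¬ Efficient A w
  closer⇒¬efficient {v = v} {w} {k} {l} v-pos v-closer vₗ≡wₗ vₖ≢wₖ (w-pos , efficient)
    with efficient v v-pos v-closer
  ... | c , _ , v≡cw = vₖ≢wₖ (begin
    v k        ≡⟨ v≡cw k ⟩
    c * w k    ≡⟨ cong (_* w k) c≡1 ⟩
    1# * w k   ≡⟨ *-identityˡ (w k) ⟩
    w k        ∎)
    where
    open ≡-Reasoning
    c≡1 : c ≡ 1#
    c≡1 = x≡y*x⇒y≡1 (>0⇒≢0 (w-pos l)) (trans (sym vₗ≡wₗ) (v≡cw l))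

  raisable⇒¬efficient : ∀ {n} {A : Matrix (suc (suc n))} {w : Vector (suc (suc n))} →
    IsReciprocal A → (k : Fin (suc (suc n))) {t : ℝ} → w k < t →
    (∀ j → j ≢ k → t ≤ A k j * w j) → ¬ Efficient A w
  raisable⇒¬efficient {A = A} {w} (A-pos , A-recip) k {t} wₖ<t t≤Aw w-efficient@(w-pos , _) =
    closer⇒¬efficient v-pos v-closer (vᵢ≡wᵢ (punchInᵢ≢i k zero)) vₖ≢wₖ w-efficient
    where
    v : Vector _
    v = updateAt w k (const t)

    vₖ≡t : v k ≡ t
    vₖ≡t = updateAt-updates k w

    vᵢ≡wᵢ : ∀ {i} → i ≢ k → v i ≡ w i
    vᵢ≡wᵢ {i} = updateAt-minimal i k w

    vₖ≢wₖ : v k ≢ w k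
    vₖ≢wₖ vₖ≡wₖ = <-irrefl′ (subst (w k <_) (trans (sym vₖ≡t) vₖ≡wₖ) wₖ<t)

    v-pos : Positive v
    v-pos i with i ≟ k
    ... | yes refl = subst (0# <_) (sym vₖ≡t) (<-trans (w-pos k) wₖ<t)
    ... | no i≢k   = subst (0# <_) (sym (vᵢ≡wᵢ i≢k)) (w-pos i)

    row-closer : ∀ {j} → j ≢ k → ∣ A k j - t / w j ∣ ≤ ∣ A k j - w k / w j ∣
    row-closer {j} j≢k =
      closer-from-below (*-monoʳ-< (⁻¹-pos (w-pos j)) wₖ<t) (x≤y*z⇒x/z≤y (w-pos j) (t≤Aw j j≢k))

    column-closer : ∀ {i} → i ≢ k → ∣ A i k - w i / t ∣ ≤ ∣ A i k - w i / w k ∣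
    column-closer {i} i≢k = closer-from-above Aᵢₖ≤wᵢ/t (*-monoˡ-< (w-pos i) (⁻¹-anti-< (w-pos k) wₖ<t))
      where
      Aᵢₖ≤wᵢ/t : A i k ≤ w i / t
      Aᵢₖ≤wᵢ/t = subst (_≤ w i / t) (sym (A-recip k i))
        (x≤y*z⇒1/y≤z/x (<-trans (w-pos k) wₖ<t) (A-pos k i) (t≤Aw i i≢k))

    v-closer : ∀ i j → ∣ A i j - v i / v j ∣ ≤ ∣ A i j - w i / w j ∣
    v-closer i j with i ≟ k | j ≟ k
    ... | yes refl | yes refl = inj₂ (cong (λ r → ∣ A i i - r ∣)
      (trans (⁻¹-inverse (v i) (>0⇒≢0 (v-pos i))) (sym (⁻¹-inverse (w i) (>0⇒≢0 (w-pos i))))))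
    ... | yes refl | no j≢k  rewrite vₖ≡t | vᵢ≡wᵢ j≢k = row-closer j≢k
    ... | no i≢k   | yes refl rewrite vᵢ≡wᵢ i≢k | vₖ≡t = column-closer i≢k
    ... | no i≢k   | no j≢k  rewrite vᵢ≡wᵢ i≢k | vᵢ≡wᵢ j≢k = inj₂ refl

module Matrix₅ (R : RealField) where
  open RealField R
  open Reciprocal R
  open OrderedFieldProperties R
  open SemiringSolver using (solve; _:=_; _:+_; _:*_; con)
  open Efficiency R using (_·_)

  -- The left-hand sides are the literal unfoldings of sumF, which solve must match definitionally.
  module _ (a₁₃ a₁₄ a₂₄ c₀ c₁ c₂ c₃ c₄ : ℝ) where
    private
      w : Vector 5
      w = A₅ a₁₃ a₁₄ a₂₄ · (c₀ ∷ c₁ ∷ c₂ ∷ c₃ ∷ c₄ ∷ [])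

    A₅·-row₀ : w 0F ≡ c₀ + c₁ + a₁₃ * c₂ + a₁₄ * c₃ + c₄
    A₅·-row₀ = solve 7 (λ c₀ c₁ c₂ c₃ c₄ a₁₃ a₁₄ →
        con 1 :* c₀ :+ (con 1 :* c₁ :+ (a₁₃ :* c₂ :+ (a₁₄ :* c₃ :+ (con 1 :* c₄ :+ con 0))))
      := c₀ :+ c₁ :+ a₁₃ :* c₂ :+ a₁₄ :* c₃ :+ c₄) refl c₀ c₁ c₂ c₃ c₄ a₁₃ a₁₄

    A₅·-row₁ : w 1F ≡ c₀ + c₁ + c₂ + a₂₄ * c₃ + c₄
    A₅·-row₁ = solve 6 (λ c₀ c₁ c₂ c₃ c₄ a₂₄ →
        con 1 :* c₀ :+ (con 1 :* c₁ :+ (con 1 :* c₂ :+ (a₂₄ :* c₃ :+ (con 1 :* c₄ :+ con 0))))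
      := c₀ :+ c₁ :+ c₂ :+ a₂₄ :* c₃ :+ c₄) refl c₀ c₁ c₂ c₃ c₄ a₂₄

    A₅·-row₂ : w 2F ≡ c₀ / a₁₃ + c₁ + c₂ + c₃ + c₄
    A₅·-row₂ = solve 6 (λ c₀ c₁ c₂ c₃ c₄ a₁₃⁻¹ →
        con 1 :* a₁₃⁻¹ :* c₀ :+ (con 1 :* c₁ :+ (con 1 :* c₂ :+ (con 1 :* c₃ :+ (con 1 :* c₄ :+ con 0))))
      := c₀ :* a₁₃⁻¹ :+ c₁ :+ c₂ :+ c₃ :+ c₄) refl c₀ c₁ c₂ c₃ c₄ (a₁₃ ⁻¹)

    A₅·-row₃ : w 3F ≡ c₀ / a₁₄ + c₁ / a₂₄ + c₂ + c₃ + c₄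
    A₅·-row₃ = solve 7 (λ c₀ c₁ c₂ c₃ c₄ a₁₄⁻¹ a₂₄⁻¹ →
        con 1 :* a₁₄⁻¹ :* c₀ :+ (con 1 :* a₂₄⁻¹ :* c₁ :+ (con 1 :* c₂ :+ (con 1 :* c₃ :+ (con 1 :* c₄ :+ con 0))))
      := c₀ :* a₁₄⁻¹ :+ c₁ :* a₂₄⁻¹ :+ c₂ :+ c₃ :+ c₄) refl c₀ c₁ c₂ c₃ c₄ (a₁₄ ⁻¹) (a₂₄ ⁻¹)

    A₅·-row₄ : w 4F ≡ c₀ + c₁ + c₂ + c₃ + c₄
    A₅·-row₄ = solve 5 (λ c₀ c₁ c₂ c₃ c₄ →
        con 1 :* c₀ :+ (con 1 :* c₁ :+ (con 1 :* c₂ :+ (con 1 :* c₃ :+ (con 1 :* c₄ :+ con 0))))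
      := c₀ :+ c₁ :+ c₂ :+ c₃ :+ c₄) refl c₀ c₁ c₂ c₃ c₄

  A₅-reciprocal : ∀ {a₁₃ a₁₄ a₂₄} → 0# < a₁₃ → 0# < a₁₄ → 0# < a₂₄ → IsReciprocal (A₅ a₁₃ a₁₄ a₂₄)
  A₅-reciprocal {a₁₃} {a₁₄} {a₂₄} 0<a₁₃ 0<a₁₄ 0<a₂₄ = positive , reciprocal
    where
    positive : ∀ i j → 0# < A₅ a₁₃ a₁₄ a₂₄ i j
    positive 0F 0F = 0<1
    positive 0F 1F = 0<1
    positive 0F 2F = 0<a₁₃
    positive 0F 3F = 0<a₁₄
    positive 0F 4F = 0<1
    positive 1F 0F = 0<1
    positive 1F 1F = 0<1
    positive 1F 2F = 0<1
    positive 1F 3F = 0<a₂₄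
    positive 1F 4F = 0<1
    positive 2F 0F = 0<1/x 0<a₁₃
    positive 2F 1F = 0<1
    positive 2F 2F = 0<1
    positive 2F 3F = 0<1
    positive 2F 4F = 0<1
    positive 3F 0F = 0<1/x 0<a₁₄
    positive 3F 1F = 0<1/x 0<a₂₄
    positive 3F 2F = 0<1
    positive 3F 3F = 0<1
    positive 3F 4F = 0<1
    positive 4F 0F = 0<1
    positive 4F 1F = 0<1
    positive 4F 2F = 0<1
    positive 4F 3F = 0<1
    positive 4F 4F = 0<1

    reciprocal : ∀ i j → A₅ a₁₃ a₁₄ a₂₄ j i ≡ 1# / A₅ a₁₃ a₁₄ a₂₄ i j
    reciprocal 0F 0F = 1≡1/1
    reciprocal 0F 1F = 1≡1/1
    reciprocal 0F 2F = refl
    reciprocal 0F 3F = refl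
    reciprocal 0F 4F = 1≡1/1
    reciprocal 1F 0F = 1≡1/1
    reciprocal 1F 1F = 1≡1/1
    reciprocal 1F 2F = 1≡1/1
    reciprocal 1F 3F = refl
    reciprocal 1F 4F = 1≡1/1
    reciprocal 2F 0F = x≡1/[1/x] 0<a₁₃
    reciprocal 2F 1F = 1≡1/1
    reciprocal 2F 2F = 1≡1/1
    reciprocal 2F 3F = 1≡1/1
    reciprocal 2F 4F = 1≡1/1
    reciprocal 3F 0F = x≡1/[1/x] 0<a₁₄
    reciprocal 3F 1F = x≡1/[1/x] 0<a₂₄
    reciprocal 3F 2F = 1≡1/1
    reciprocal 3F 3F = 1≡1/1
    reciprocal 3F 4F = 1≡1/1
    reciprocal 4F 0F = 1≡1/1
    reciprocal 4F 1F = 1≡1/1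
    reciprocal 4F 2F = 1≡1/1
    reciprocal 4F 3F = 1≡1/1
    reciprocal 4F 4F = 1≡1/1

module Case₁ (R : RealField) where
  open RealField R
  open Reciprocal R
  open OrderedFieldProperties R
  open SemiringSolver using (solve; _:=_; _:+_; _:*_; con)
  open Efficiency R
  open Matrix₅ R
  open IsCommutativeRing isCommutativeRing using (*-identityˡ)

  -- Positive gaps instead of differences, since the semiring solver cannot subtract.
  module Gaps {e f g : ℝ} (0<e : 0# < e) (0<f : 0# < f) (0<g : 0# < g) where
    a₂₄ a₁₄ a₁₃ s : ℝ
    a₂₄ = 1# + e
    a₁₄ = a₂₄ + f
    a₁₃ = a₁₄ + g
    s = e + f + g

    0<a₂₄ : 0# < a₂₄
    0<a₂₄ = +-pos 0<1 0<e
    0<a₁₄ : 0# < a₁₄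
    0<a₁₄ = +-pos 0<a₂₄ 0<f
    0<a₁₃ : 0# < a₁₃
    0<a₁₃ = +-pos 0<a₁₄ 0<g
    0<s : 0# < s
    0<s = +-pos (+-pos 0<e 0<f) 0<g

    c : Vector 5
    c = e * a₁₃ ∷ g ∷ f ∷ 0# ∷ 0# ∷ []

    w : Vector 5
    w = A₅ a₁₃ a₁₄ a₂₄ · c

    w₀≡a₁₄*s : w 0F ≡ a₁₄ * s
    w₀≡a₁₄*s = trans (A₅·-row₀ a₁₃ a₁₄ a₂₄ (e * a₁₃) g f 0# 0#) (solve 3 (λ e f g →
        let a₁₄ = con 1 :+ e :+ f ; a₁₃ = a₁₄ :+ g in
        e :* a₁₃ :+ g :+ a₁₃ :* f :+ a₁₄ :* con 0 :+ con 0 := a₁₄ :* (e :+ f :+ g)) refl e f g)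

    w₁≡a₂₄*s : w 1F ≡ a₂₄ * s
    w₁≡a₂₄*s = trans (A₅·-row₁ a₁₃ a₁₄ a₂₄ (e * a₁₃) g f 0# 0#) (solve 3 (λ e f g →
        let a₂₄ = con 1 :+ e ; a₁₃ = a₂₄ :+ f :+ g in
        e :* a₁₃ :+ g :+ f :+ a₂₄ :* con 0 :+ con 0 := a₂₄ :* (e :+ f :+ g)) refl e f g)

    w₂≡s : w 2F ≡ s
    w₂≡s = begin
      w 2F                                     ≡⟨ A₅·-row₂ a₁₃ a₁₄ a₂₄ (e * a₁₃) g f 0# 0# ⟩
      e * a₁₃ / a₁₃ + g + f + 0# + 0#          ≡⟨ cong (λ x → x + g + f + 0# + 0#) (x*y/y≡x (>0⇒≢0 0<a₁₃)) ⟩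
      e + g + f + 0# + 0#                      ≡⟨ solve 3 (λ e f g → e :+ g :+ f :+ con 0 :+ con 0 := e :+ f :+ g)
                                                    refl e f g ⟩
      s                                        ∎
      where open ≡-Reasoning

    w₃<s : w 3F < s
    w₃<s = x*y+a≡x*z⇒y<z (*-pos 0<a₁₄ 0<a₂₄) (*-pos (*-pos 0<e 0<f) 0<g) (begin
      a₁₄ * a₂₄ * w 3F + e * f * g
        ≡⟨ cong (λ x → a₁₄ * a₂₄ * x + e * f * g) (A₅·-row₃ a₁₃ a₁₄ a₂₄ (e * a₁₃) g f 0# 0#) ⟩
      a₁₄ * a₂₄ * (e * a₁₃ / a₁₄ + g / a₂₄ + f + 0# + 0#) + e * f * g
        ≡⟨ solve 5 (λ e f g a₁₄⁻¹ a₂₄⁻¹ →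
             let a₂₄ = con 1 :+ e ; a₁₄ = a₂₄ :+ f ; a₁₃ = a₁₄ :+ g in
             a₁₄ :* a₂₄ :* (e :* a₁₃ :* a₁₄⁻¹ :+ g :* a₂₄⁻¹ :+ f :+ con 0 :+ con 0) :+ e :* f :* g
             := a₂₄ :* e :* a₁₃ :* (a₁₄ :* a₁₄⁻¹) :+ a₁₄ :* g :* (a₂₄ :* a₂₄⁻¹) :+ a₁₄ :* a₂₄ :* f :+ e :* f :* g)
             refl e f g (a₁₄ ⁻¹) (a₂₄ ⁻¹) ⟩
      a₂₄ * e * a₁₃ * (a₁₄ / a₁₄) + a₁₄ * g * (a₂₄ / a₂₄) + a₁₄ * a₂₄ * f + e * f * g
        ≡⟨ cong₂ (λ x y → a₂₄ * e * a₁₃ * x + a₁₄ * g * y + a₁₄ * a₂₄ * f + e * f * g)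
             (⁻¹-inverse a₁₄ (>0⇒≢0 0<a₁₄)) (⁻¹-inverse a₂₄ (>0⇒≢0 0<a₂₄)) ⟩
      a₂₄ * e * a₁₃ * 1# + a₁₄ * g * 1# + a₁₄ * a₂₄ * f + e * f * g
        ≡⟨ solve 3 (λ e f g →
             let a₂₄ = con 1 :+ e ; a₁₄ = a₂₄ :+ f ; a₁₃ = a₁₄ :+ g in
             a₂₄ :* e :* a₁₃ :* con 1 :+ a₁₄ :* g :* con 1 :+ a₁₄ :* a₂₄ :* f :+ e :* f :* g
             := a₁₄ :* a₂₄ :* (e :+ f :+ g)) refl e f g ⟩
      a₁₄ * a₂₄ * s ∎)
      where open ≡-Reasoning

    w₄≡s+e*s : w 4F ≡ s + e * s
    w₄≡s+e*s = trans (A₅·-row₄ a₁₃ a₁₄ a₂₄ (e * a₁₃) g f 0# 0#) (solve 3 (λ e f g →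
        e :* (con 1 :+ e :+ f :+ g) :+ g :+ f :+ con 0 :+ con 0 := e :+ f :+ g :+ e :* (e :+ f :+ g))
      refl e f g)

    s≤A₃ⱼ*wⱼ : ∀ j → j ≢ 3F → s ≤ A₅ a₁₃ a₁₄ a₂₄ 3F j * w j
    s≤A₃ⱼ*wⱼ 0F _   = inj₂ (sym (trans (cong (1# / a₁₄ *_) w₀≡a₁₄*s) ([1/x]*[x*y]≡y (>0⇒≢0 0<a₁₄))))
    s≤A₃ⱼ*wⱼ 1F _   = inj₂ (sym (trans (cong (1# / a₂₄ *_) w₁≡a₂₄*s) ([1/x]*[x*y]≡y (>0⇒≢0 0<a₂₄))))
    s≤A₃ⱼ*wⱼ 2F _   = inj₂ (sym (trans (*-identityˡ (w 2F)) w₂≡s))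
    s≤A₃ⱼ*wⱼ 3F 3≢3 = contradiction refl 3≢3
    s≤A₃ⱼ*wⱼ 4F _   = inj₁ (subst (s <_) (sym (trans (*-identityˡ (w 4F)) w₄≡s+e*s)) (x<x+y (*-pos 0<e 0<s)))

    ¬𝒞⊆ℰ : ¬ 𝒞⊆ℰ (A₅ a₁₃ a₁₄ a₂₄)
    ¬𝒞⊆ℰ cone⊆efficient = raisable⇒¬efficient (A₅-reciprocal 0<a₁₃ 0<a₁₄ 0<a₂₄) 3F w₃<s s≤A₃ⱼ*wⱼ (cone⊆efficient w w∈𝒞)
      where
      0≤c : ∀ j → 0# ≤ c j
      0≤c 0F = inj₁ (*-pos 0<e 0<a₁₃)
      0≤c 1F = inj₁ 0<g
      0≤c 2F = inj₁ 0<f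
      0≤c 3F = inj₂ refl
      0≤c 4F = inj₂ refl
      w∈𝒞 : InCone (A₅ a₁₃ a₁₄ a₂₄) w
      w∈𝒞 = ·-inCone (A₅ a₁₃ a₁₄ a₂₄) 0≤c 2F (subst (_≢ 0#) (sym w₂≡s) (>0⇒≢0 0<s))

  ¬𝒞⊆ℰ-if-1<a₂₄<a₁₄<a₁₃ : ∀ {a₁₃ a₁₄ a₂₄} → 1# < a₂₄ → a₂₄ < a₁₄ → a₁₄ < a₁₃ →
                            ¬ 𝒞⊆ℰ (A₅ a₁₃ a₁₄ a₂₄)
  ¬𝒞⊆ℰ-if-1<a₂₄<a₁₄<a₁₃ 1<a₂₄ a₂₄<a₁₄ a₁₄<a₁₃ =
    by-gaps (x<y⇒0<y-x 1<a₂₄) (x<y⇒0<y-x a₂₄<a₁₄) (x<y⇒0<y-x a₁₄<a₁₃)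
            (sym x+[y-x]≡y) (sym x+[y-x]≡y) (sym x+[y-x]≡y)
    where
    by-gaps : ∀ {e f g a₁₃ a₁₄ a₂₄} → 0# < e → 0# < f → 0# < g →
              a₂₄ ≡ 1# + e → a₁₄ ≡ a₂₄ + f → a₁₃ ≡ a₁₄ + g → ¬ 𝒞⊆ℰ (A₅ a₁₃ a₁₄ a₂₄)
    by-gaps 0<e 0<f 0<g refl refl refl = Gaps.¬𝒞⊆ℰ 0<e 0<f 0<g

module Case₂ (R : RealField) where
  open RealField R
  open Reciprocal R
  open OrderedFieldProperties R
  open SemiringSolver using (solve; _:=_; _:+_; _:*_; con)
  open Efficiency R
  open Matrix₅ R
  open IsCommutativeRing isCommutativeRing using (*-identityˡ)

  -- The solver cannot use b + h ≡ 1, so each identity passes through a form P (b + h),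
  -- which is then rewritten to P 1.
  module Gaps {b h k m : ℝ} (b+h≡1 : b + h ≡ 1#)
           (0<b : 0# < b) (0<h : 0# < h) (0<k : 0# < k) (0<m : 0# < m) where
    a₁₃ a₁₄ s : ℝ
    a₁₃ = 1# + k
    a₁₄ = a₁₃ + m
    s = m + k + h

    0<a₁₃ : 0# < a₁₃
    0<a₁₃ = +-pos 0<1 0<k
    0<a₁₄ : 0# < a₁₄
    0<a₁₄ = +-pos 0<a₁₃ 0<m
    0<s : 0# < s
    0<s = +-pos (+-pos 0<m 0<k) 0<h

    c : Vector 5
    c = h * a₁₄ ∷ m * b ∷ 0# ∷ k ∷ 0# ∷ []

    w : Vector 5
    w = A₅ a₁₃ a₁₄ b · c

    w₀≡a₁₃*s : w 0F ≡ a₁₃ * s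
    w₀≡a₁₃*s = begin
      w 0F
        ≡⟨ A₅·-row₀ a₁₃ a₁₄ b (h * a₁₄) (m * b) 0# k 0# ⟩
      h * a₁₄ + m * b + a₁₃ * 0# + a₁₄ * k + 0#
        ≡⟨ solve 4 (λ b h k m → let a₁₃ = con 1 :+ k ; a₁₄ = a₁₃ :+ m in
             h :* a₁₄ :+ m :* b :+ a₁₃ :* con 0 :+ a₁₄ :* k :+ con 0
             := m :* (b :+ h) :+ (h :+ h :* k :+ k :+ k :* k :+ m :* k)) refl b h k m ⟩
      m * (b + h) + (h + h * k + k + k * k + m * k)
        ≡⟨ cong (λ x → m * x + (h + h * k + k + k * k + m * k)) b+h≡1 ⟩
      m * 1# + (h + h * k + k + k * k + m * k)
        ≡⟨ solve 3 (λ h k m → m :* con 1 :+ (h :+ h :* k :+ k :+ k :* k :+ m :* k)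
             := (con 1 :+ k) :* (m :+ k :+ h)) refl h k m ⟩
      a₁₃ * s ∎
      where open ≡-Reasoning

    w₁≡s : w 1F ≡ s
    w₁≡s = begin
      w 1F
        ≡⟨ A₅·-row₁ a₁₃ a₁₄ b (h * a₁₄) (m * b) 0# k 0# ⟩
      h * a₁₄ + m * b + 0# + b * k + 0#
        ≡⟨ solve 4 (λ b h k m → h :* (con 1 :+ k :+ m) :+ m :* b :+ con 0 :+ b :* k :+ con 0
             := (m :+ k) :* (b :+ h) :+ h) refl b h k m ⟩
      (m + k) * (b + h) + h
        ≡⟨ cong (λ x → (m + k) * x + h) b+h≡1 ⟩
      (m + k) * 1# + h
        ≡⟨ solve 3 (λ h k m → (m :+ k) :* con 1 :+ h := m :+ k :+ h) refl h k m ⟩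
      s ∎
      where open ≡-Reasoning

    w₂<s : w 2F < s
    w₂<s = x*y+a≡x*z⇒y<z 0<a₁₃ (*-pos (*-pos 0<k 0<m) 0<h) (begin
      a₁₃ * w 2F + k * m * h
        ≡⟨ cong (λ x → a₁₃ * x + k * m * h) (A₅·-row₂ a₁₃ a₁₄ b (h * a₁₄) (m * b) 0# k 0#) ⟩
      a₁₃ * (h * a₁₄ / a₁₃ + m * b + 0# + k + 0#) + k * m * h
        ≡⟨ solve 5 (λ b h k m a₁₃⁻¹ → let a₁₃ = con 1 :+ k ; a₁₄ = a₁₃ :+ m in
             a₁₃ :* (h :* a₁₄ :* a₁₃⁻¹ :+ m :* b :+ con 0 :+ k :+ con 0) :+ k :* m :* h
             := h :* a₁₄ :* (a₁₃ :* a₁₃⁻¹) :+ a₁₃ :* m :* b :+ a₁₃ :* k :+ k :* m :* h)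
             refl b h k m (a₁₃ ⁻¹) ⟩
      h * a₁₄ * (a₁₃ / a₁₃) + a₁₃ * m * b + a₁₃ * k + k * m * h
        ≡⟨ cong (λ x → h * a₁₄ * x + a₁₃ * m * b + a₁₃ * k + k * m * h) (⁻¹-inverse a₁₃ (>0⇒≢0 0<a₁₃)) ⟩
      h * a₁₄ * 1# + a₁₃ * m * b + a₁₃ * k + k * m * h
        ≡⟨ solve 4 (λ b h k m → let a₁₃ = con 1 :+ k ; a₁₄ = a₁₃ :+ m in
             h :* a₁₄ :* con 1 :+ a₁₃ :* m :* b :+ a₁₃ :* k :+ k :* m :* h
             := a₁₃ :* m :* (b :+ h) :+ (h :+ h :* k :+ k :+ k :* k)) refl b h k m ⟩
      a₁₃ * m * (b + h) + (h + h * k + k + k * k)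
        ≡⟨ cong (λ x → a₁₃ * m * x + (h + h * k + k + k * k)) b+h≡1 ⟩
      a₁₃ * m * 1# + (h + h * k + k + k * k)
        ≡⟨ solve 3 (λ h k m → (con 1 :+ k) :* m :* con 1 :+ (h :+ h :* k :+ k :+ k :* k)
             := (con 1 :+ k) :* (m :+ k :+ h)) refl h k m ⟩
      a₁₃ * s ∎)
      where open ≡-Reasoning

    w₃≡s : w 3F ≡ s
    w₃≡s = begin
      w 3F
        ≡⟨ A₅·-row₃ a₁₃ a₁₄ b (h * a₁₄) (m * b) 0# k 0# ⟩
      h * a₁₄ / a₁₄ + m * b / b + 0# + k + 0#
        ≡⟨ cong₂ (λ x y → x + y + 0# + k + 0#) (x*y/y≡x (>0⇒≢0 0<a₁₄)) (x*y/y≡x (>0⇒≢0 0<b)) ⟩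
      h + m + 0# + k + 0#
        ≡⟨ solve 3 (λ h k m → h :+ m :+ con 0 :+ k :+ con 0 := m :+ k :+ h) refl h k m ⟩
      s ∎
      where open ≡-Reasoning

    w₄≡s+h*k : w 4F ≡ s + h * k
    w₄≡s+h*k = begin
      w 4F
        ≡⟨ A₅·-row₄ a₁₃ a₁₄ b (h * a₁₄) (m * b) 0# k 0# ⟩
      h * a₁₄ + m * b + 0# + k + 0#
        ≡⟨ solve 4 (λ b h k m → h :* (con 1 :+ k :+ m) :+ m :* b :+ con 0 :+ k :+ con 0
             := m :* (b :+ h) :+ (h :+ h :* k :+ k)) refl b h k m ⟩
      m * (b + h) + (h + h * k + k)
        ≡⟨ cong (λ x → m * x + (h + h * k + k)) b+h≡1 ⟩
      m * 1# + (h + h * k + k)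
        ≡⟨ solve 3 (λ h k m → m :* con 1 :+ (h :+ h :* k :+ k) := m :+ k :+ h :+ h :* k) refl h k m ⟩
      s + h * k ∎
      where open ≡-Reasoning

    s≤A₂ⱼ*wⱼ : ∀ j → j ≢ 2F → s ≤ A₅ a₁₃ a₁₄ b 2F j * w j
    s≤A₂ⱼ*wⱼ 0F _   = inj₂ (sym (trans (cong (1# / a₁₃ *_) w₀≡a₁₃*s) ([1/x]*[x*y]≡y (>0⇒≢0 0<a₁₃))))
    s≤A₂ⱼ*wⱼ 1F _   = inj₂ (sym (trans (*-identityˡ (w 1F)) w₁≡s))
    s≤A₂ⱼ*wⱼ 2F 2≢2 = contradiction refl 2≢2
    s≤A₂ⱼ*wⱼ 3F _   = inj₂ (sym (trans (*-identityˡ (w 3F)) w₃≡s))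
    s≤A₂ⱼ*wⱼ 4F _   = inj₁ (subst (s <_) (sym (trans (*-identityˡ (w 4F)) w₄≡s+h*k)) (x<x+y (*-pos 0<h 0<k)))

    ¬𝒞⊆ℰ : ¬ 𝒞⊆ℰ (A₅ a₁₃ a₁₄ b)
    ¬𝒞⊆ℰ cone⊆efficient = raisable⇒¬efficient (A₅-reciprocal 0<a₁₃ 0<a₁₄ 0<b) 2F w₂<s s≤A₂ⱼ*wⱼ (cone⊆efficient w w∈𝒞)
      where
      0≤c : ∀ j → 0# ≤ c j
      0≤c 0F = inj₁ (*-pos 0<h 0<a₁₄)
      0≤c 1F = inj₁ (*-pos 0<m 0<b)
      0≤c 2F = inj₂ refl
      0≤c 3F = inj₁ 0<k
      0≤c 4F = inj₂ refl
      w∈𝒞 : InCone (A₅ a₁₃ a₁₄ b) w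
      w∈𝒞 = ·-inCone (A₅ a₁₃ a₁₄ b) 0≤c 1F (subst (_≢ 0#) (sym w₁≡s) (>0⇒≢0 0<s))

  ¬𝒞⊆ℰ-if-a₂₄<1<a₁₃<a₁₄ : ∀ {a₁₃ a₁₄ a₂₄} → 0# < a₂₄ → a₂₄ < 1# → 1# < a₁₃ → a₁₃ < a₁₄ →
                            ¬ 𝒞⊆ℰ (A₅ a₁₃ a₁₄ a₂₄)
  ¬𝒞⊆ℰ-if-a₂₄<1<a₁₃<a₁₄ 0<a₂₄ a₂₄<1 1<a₁₃ a₁₃<a₁₄ =
    by-gaps x+[y-x]≡y 0<a₂₄ (x<y⇒0<y-x a₂₄<1) (x<y⇒0<y-x 1<a₁₃) (x<y⇒0<y-x a₁₃<a₁₄)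
            (sym x+[y-x]≡y) (sym x+[y-x]≡y)
    where
    by-gaps : ∀ {b h k m a₁₃ a₁₄} → b + h ≡ 1# → 0# < b → 0# < h → 0# < k → 0# < m →
              a₁₃ ≡ 1# + k → a₁₄ ≡ a₁₃ + m → ¬ 𝒞⊆ℰ (A₅ a₁₃ a₁₄ b)
    by-gaps b+h≡1 0<b 0<h 0<k 0<m refl refl = Gaps.¬𝒞⊆ℰ b+h≡1 0<b 0<h 0<k 0<m

mainTheorem11 : (R : RealField) → let open RealField R in let open Reciprocal R in
    (a₁₃ a₁₄ a₂₄ : ℝ) → 0# < a₁₃ → 0# < a₁₄ → 0# < a₂₄ →
    ((1# < a₂₄ × a₂₄ < a₁₄ × a₁₄ < a₁₃) ⊎ (a₂₄ < 1# × 1# < a₁₃ × a₁₃ < a₁₄)) →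
    ¬ (∀ w → InCone (A₅ a₁₃ a₁₄ a₂₄) w → Efficient (A₅ a₁₃ a₁₄ a₂₄) w)
mainTheorem11 R _ _ _ _ _ _ (inj₁ (1<a₂₄ , a₂₄<a₁₄ , a₁₄<a₁₃)) =
  Case₁.¬𝒞⊆ℰ-if-1<a₂₄<a₁₄<a₁₃ R 1<a₂₄ a₂₄<a₁₄ a₁₄<a₁₃
mainTheorem11 R _ _ _ _ _ 0<a₂₄ (inj₂ (a₂₄<1 , 1<a₁₃ , a₁₃<a₁₄)) =
  Case₂.¬𝒞⊆ℰ-if-a₂₄<1<a₁₃<a₁₄ R 0<a₂₄ a₂₄<1 1<a₁₃ a₁₃<a₁₄
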